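{- Every finite simple graph having at most four vertices is a sesquicograph.
   Context: For vertex-disjoint graphs $G$ and $H$: the $0$-sum is their disjoint union; a $1$-sum is obtained from the disjoint union by identifying one vertex of $G$ with one vertex of $H$; the join is obtained from the disjoint union by adding all edges between $V(G)$ and $V(H)$. A sesquicograph is a graph that can be generated from the one-vertex graph $K_1$ using joins, $0$-sums and $1$-sums. -}

module Defs where

open import Data.Nat using (ℕ; zero; suc; _+_)
open import Data.Bool using (Bool; true; false; _∧_; if_then_else_)
open import Data.Fin using (Fin; zero; suc; splitAt; _↑ˡ_; _↑ʳ_; punchIn)
open import Data.Fin.Properties using (_≟_)
open import Data.Sum using (_⊎_; inj₁; inj₂)
open import Relation.Nullary.Decidable using (⌊_⌋)
open import Relation.Binary.PropositionalEquality using (_≡_)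
open import Function.Bundles using (_↔_; Inverse)

record Graph : Set where
  constructor mkGraph
  field
    order : ℕ
    adj   : Fin order → Fin order → Bool
open Graph public

record IsSimple (G : Graph) : Set where
  field
    symmetric   : ∀ u v → adj G u v ≡ adj G v u
    irreflexive : ∀ u → adj G u u ≡ false

record _≅_ (G H : Graph) : Set where
  field
    bij      : Fin (order G) ↔ Fin (order H)
    preserve : ∀ u v → adj G u v ≡ adj H (Inverse.to bij u) (Inverse.to bij v)

K₁ : Graph
K₁ = mkGraph 1 (λ _ _ → false)

-- Vertices of G are Fin m ↑ˡ, vertices of H are m ↑ʳ Fin n.
-- cross decides adjacency between a G-vertex and an H-vertex.
private
  combine : (G H : Graph) → (Fin (order G) → Fin (order H) → Bool) →
            Fin (order G + order H) → Fin (order G + order H) → Bool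
  combine G H cross x y with splitAt (order G) x | splitAt (order G) y
  ... | inj₁ a | inj₁ b = adj G a b
  ... | inj₂ c | inj₂ d = adj H c d
  ... | inj₁ a | inj₂ d = cross a d
  ... | inj₂ c | inj₁ b = cross b c

sum0 : Graph → Graph → Graph
sum0 G H = mkGraph (order G + order H) (combine G H (λ _ _ → false))

join : Graph → Graph → Graph
join G H = mkGraph (order G + order H) (combine G H (λ _ _ → true))

-- 1-sum: identify vertex u of G with vertex v of H (H has suc k vertices).
-- Vertex set: Fin (order G + k); the first order G vertices are those of G
-- (u also playing the role of v), the remaining k are the vertices of H
-- other than v, listed via punchIn v.
sum1 : (G : Graph) (k : ℕ) (adjH : Fin (suc k) → Fin (suc k) → Bool)
       (u : Fin (order G)) (v : Fin (suc k)) → Graph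
sum1 G k adjH u v = mkGraph (order G + k) f
  where
  H' : Graph
  H' = mkGraph k (λ c d → adjH (punchIn v c) (punchIn v d))
  f : Fin (order G + k) → Fin (order G + k) → Bool
  f = combine G H' (λ a d → ⌊ a ≟ u ⌋ ∧ adjH v (punchIn v d))

data Sesquicograph : Graph → Set where
  k1   : Sesquicograph K₁
  iso  : ∀ {G H} → Sesquicograph G → G ≅ H → Sesquicograph H
  s0   : ∀ {G H} → Sesquicograph G → Sesquicograph H → Sesquicograph (sum0 G H)
  jn   : ∀ {G H} → Sesquicograph G → Sesquicograph H → Sesquicograph (join G H)
  s1   : ∀ {G k adjH} → Sesquicograph G → Sesquicograph (mkGraph (suc k) adjH) →
         (u : Fin (order G)) (v : Fin (suc k)) → Sesquicograph (sum1 G k adjH u v)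

-- A simple graph on vertices 0, …, n is the cone over its restriction to
-- 1, …, n with apex 0 joined to the neighbourhood of 0, so iterating this
-- enumerates every simple graph on n vertices up to pointwise equality of
-- adjacency.  For n ≤ 4 a computation then finds each enumerated graph to be a
-- relabelling of one of a few explicit sesquicographs: all of them cographs
-- (built by joins and 0-sums) except P₄, which is a 1-sum of P₃ and K₂.
module Submission where

open import Defs
open import Data.Nat using (ℕ; zero; suc; _≤_; _<_; s≤s)
open import Data.Bool using (Bool; false)
open import Data.Bool.Properties using () renaming (_≟_ to _≟ᴮ_)
open import Data.Fin using (Fin; zero; suc)
open import Data.Fin.Properties using (all?)
open import Data.Fin.Subset using (Subset)
open import Data.Fin.Subset.Properties using (anySubset?)
open import Data.Fin.Permutation using (Permutation′; _⟨$⟩ʳ_; _⟨$⟩ˡ_; inverseˡ; id; insert)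
open import Data.Vec using (lookup; tabulate)
open import Data.Vec.Properties using (lookup∘tabulate)
open import Data.List using (List; []; _∷_; concatMap; map; allFin)
open import Data.List.Relation.Unary.Any as Any using (Any; any?)
open import Data.Product using (Σ; _,_; proj₁)
open import Relation.Nullary using (Dec; ¬?)
open import Relation.Nullary.Decidable using (True; toWitness; map′; decidable-stable)
open import Relation.Unary using (Pred; Decidable)
open import Relation.Binary.PropositionalEquality using (_≡_; refl; sym; trans; cong₂)
open import Function using (_∘_)
open import Level using (0ℓ)

Adj : ℕ → Set
Adj n = Fin n → Fin n → Bool

infix 4 _≗₂_
_≗₂_ : ∀ {n} → Adj n → Adj n → Set
a ≗₂ b = ∀ u v → a u v ≡ b u v

_≗₂?_ : ∀ {n} (a b : Adj n) → Dec (a ≗₂ b)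
a ≗₂? b = all? λ u → all? λ v → a u v ≟ᴮ b u v

≗₂-sym : ∀ {n} {a b : Adj n} → a ≗₂ b → b ≗₂ a
≗₂-sym p u v = sym (p u v)

≗₂-trans : ∀ {n} {a b c : Adj n} → a ≗₂ b → b ≗₂ c → a ≗₂ c
≗₂-trans p q u v = trans (p u v) (q u v)

relabel : ∀ {n} → Permutation′ n → Adj n → Adj n
relabel π a u v = a (π ⟨$⟩ˡ u) (π ⟨$⟩ˡ v)

≅-relabel : ∀ {n} (π : Permutation′ n) {a b : Adj n} →
            b ≗₂ relabel π a → mkGraph n a ≅ mkGraph n b
≅-relabel π {a} {b} b≗πa = record
  { bij      = π
  ; preserve = λ u v → trans (cong₂ a (sym (inverseˡ π)) (sym (inverseˡ π)))
                             (sym (b≗πa (π ⟨$⟩ʳ u) (π ⟨$⟩ʳ v)))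
  }

permutations : ∀ n → List (Permutation′ n)
permutations zero    = id ∷ []
permutations (suc n) =
  concatMap (λ j → map (insert zero j) (permutations n)) (allFin (suc n))

cone : ∀ {n} → Subset n → Adj n → Adj (suc n)
cone s b zero    zero    = false
cone s b zero    (suc v) = lookup s v
cone s b (suc u) zero    = lookup s u
cone s b (suc u) (suc v) = b u v

cone-cong : ∀ {n} (s : Subset n) {b c : Adj n} → b ≗₂ c → cone s b ≗₂ cone s c
cone-cong s b≗c zero    zero    = refl
cone-cong s b≗c zero    (suc v) = refl
cone-cong s b≗c (suc u) zero    = refl
cone-cong s b≗c (suc u) (suc v) = b≗c u v

neighbours₀ : ∀ {n} → Adj (suc n) → Subset n
neighbours₀ a = tabulate (a zero ∘ suc)

delete₀ : ∀ {n} → Adj (suc n) → Adj n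
delete₀ a u v = a (suc u) (suc v)

delete₀-simple : ∀ {n} {a : Adj (suc n)} →
                 IsSimple (mkGraph (suc n) a) → IsSimple (mkGraph n (delete₀ a))
delete₀-simple simple = record
  { symmetric   = λ u v → IsSimple.symmetric simple (suc u) (suc v)
  ; irreflexive = IsSimple.irreflexive simple ∘ suc
  }

simple≗cone : ∀ {n} {a : Adj (suc n)} → IsSimple (mkGraph (suc n) a) →
              a ≗₂ cone (neighbours₀ a) (delete₀ a)
simple≗cone simple zero    zero    = IsSimple.irreflexive simple zero
simple≗cone {a = a} simple zero    (suc v) = sym (lookup∘tabulate (a zero ∘ suc) v)
simple≗cone {a = a} simple (suc u) zero    =
  trans (IsSimple.symmetric simple (suc u) zero) (sym (lookup∘tabulate (a zero ∘ suc) u))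
simple≗cone simple (suc u) (suc v) = refl

allSubsets? : ∀ {n} {P : Pred (Subset n) 0ℓ} → Decidable P → Dec (∀ s → P s)
allSubsets? P? = map′ (λ ∄¬ s → decidable-stable (P? s) (λ ¬p → ∄¬ (s , ¬p)))
                      (λ ∀p (s , ¬p) → ¬p (∀p s))
                      (¬? (anySubset? (¬? ∘ P?)))

AllSimple : ∀ n → Pred (Adj n) 0ℓ → Set
AllSimple zero    P = P λ ()
AllSimple (suc n) P = AllSimple n λ b → ∀ s → P (cone s b)

allSimple? : ∀ n {P : Pred (Adj n) 0ℓ} → Decidable P → Dec (AllSimple n P)
allSimple? zero    P? = P? _
allSimple? (suc n) P? = allSimple? n λ b → allSubsets? λ s → P? (cone s b)

allSimple-sound : ∀ n {P : Pred (Adj n) 0ℓ} → (∀ {a b} → a ≗₂ b → P a → P b) →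
                  AllSimple n P → ∀ a → IsSimple (mkGraph n a) → P a
allSimple-sound zero    resp checked a _ = resp (λ ()) checked
allSimple-sound (suc n) resp checked a simple =
  resp (λ u v → sym (simple≗cone simple u v))
       (allSimple-sound n (λ b≗c f s → resp (cone-cong s b≗c) (f s)) checked
                        (delete₀ a) (delete₀-simple simple) (neighbours₀ a))

SesquicographOn : ℕ → Set
SesquicographOn n = Σ (Adj n) λ a → Sesquicograph (mkGraph n a)

asSesquicographOn : ∀ {G} → Sesquicograph G → SesquicographOn (order G)
asSesquicographOn {G} s = adj G , s

IsoToOneOf : ∀ {n} → List (SesquicographOn n) → Pred (Adj n) 0ℓ
IsoToOneOf {n} gs b = Any (λ g → Any (λ π → b ≗₂ relabel π (proj₁ g)) (permutations n)) gs

isoToOneOf? : ∀ {n} (gs : List (SesquicographOn n)) → Decidable (IsoToOneOf gs)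
isoToOneOf? {n} gs b = any? (λ g → any? (λ π → b ≗₂? relabel π (proj₁ g)) (permutations n)) gs

isoToOneOf-resp : ∀ {n} {gs : List (SesquicographOn n)} {a b : Adj n} →
                  a ≗₂ b → IsoToOneOf gs a → IsoToOneOf gs b
isoToOneOf-resp a≗b = Any.map (Any.map (≗₂-trans (≗₂-sym a≗b)))

isoToOneOf⇒sesquicograph : ∀ {n} {gs : List (SesquicographOn n)} {b : Adj n} →
                           IsoToOneOf gs b → Sesquicograph (mkGraph n b)
isoToOneOf⇒sesquicograph b∼gs with Any.satisfied b∼gs
... | (a , a-sesqui) , b∼πa with Any.satisfied b∼πa
...   | π , b≗πa = iso a-sesqui (≅-relabel π b≗πa)

smallSesquicographs : ∀ n → List (SesquicographOn n)
smallSesquicographs 1 = asSesquicographOn k1 ∷ []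
smallSesquicographs 2 = asSesquicographOn (s0 k1 k1)
                      ∷ asSesquicographOn (jn k1 k1)
                      ∷ []
smallSesquicographs 3 = asSesquicographOn (s0 k1 (s0 k1 k1))
                      ∷ asSesquicographOn (s0 (jn k1 k1) k1)
                      ∷ asSesquicographOn (jn k1 (s0 k1 k1))
                      ∷ asSesquicographOn (jn k1 (jn k1 k1))
                      ∷ []
smallSesquicographs 4 = asSesquicographOn (s0 k1 (s0 k1 (s0 k1 k1)))
                      ∷ asSesquicographOn (s0 (jn k1 k1) (s0 k1 k1))
                      ∷ asSesquicographOn (s0 (jn k1 k1) (jn k1 k1))
                      ∷ asSesquicographOn (s0 (jn k1 (s0 k1 k1)) k1)
                      ∷ asSesquicographOn (s0 (jn k1 (jn k1 k1)) k1)
                      ∷ asSesquicographOn (jn k1 (s0 k1 (s0 k1 k1)))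
                      ∷ asSesquicographOn (jn k1 (s0 (jn k1 k1) k1))
                      ∷ asSesquicographOn (jn (s0 k1 k1) (s0 k1 k1))
                      ∷ asSesquicographOn (jn (s0 k1 k1) (jn k1 k1))
                      ∷ asSesquicographOn (jn k1 (jn k1 (jn k1 k1)))
                      -- P₄, the only graph on four vertices that is not a cograph:
                      -- a leaf of P₃ glued to an end of K₂.
                      ∷ asSesquicographOn (s1 {adjH = adj (join K₁ K₁)}
                                              (jn k1 (s0 k1 k1)) (jn k1 k1) (suc zero) zero)
                      ∷ []
smallSesquicographs _ = []

everySmallSimpleGraphIsoToOneOf : ∀ n → 0 < n → n ≤ 4 →
  True (allSimple? n (isoToOneOf? (smallSesquicographs n)))
everySmallSimpleGraphIsoToOneOf 1 _ _ = _
everySmallSimpleGraphIsoToOneOf 2 _ _ = _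
everySmallSimpleGraphIsoToOneOf 3 _ _ = _
everySmallSimpleGraphIsoToOneOf 4 _ _ = _
everySmallSimpleGraphIsoToOneOf (suc (suc (suc (suc (suc _))))) _ (s≤s (s≤s (s≤s (s≤s ()))))

lemma2p1 : (G : Graph) → IsSimple G → 0 < order G → order G ≤ 4 → Sesquicograph G
lemma2p1 (mkGraph n a) simple 0<n n≤4 =
  isoToOneOf⇒sesquicograph
    (allSimple-sound n isoToOneOf-resp
       (toWitness (everySmallSimpleGraphIsoToOneOf n 0<n n≤4)) a simple)
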